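{- The class of 3-regular planar graphs on at least 5 vertices is $T_3$-reconstructible.
   Context: Graphs are finite, simple, connected and labeled; two labeled graphs are identical iff they have the same vertex set and edge set. $T_3(G)$ is the set of 3-element subsets of $V(G)$ inducing a connected subgraph of $G$. A class $\mathcal{C}$ of graphs is $T_3$-reconstructible if any two distinct labeled graphs $G_1 \neq G_2$ in $\mathcal{C}$ satisfy $T_3(G_1) \neq T_3(G_2)$. -}

module Defs where

open import Data.Nat using (ℕ; zero; suc; _+_; _*_; _≤ᵇ_; _≤_)
open import Data.Fin using (Fin; toℕ)
open import Data.Bool using (Bool; true; false; _∧_; _∨_; not)
open import Data.Product using (_×_; _,_; Σ; ∃; proj₁; proj₂)
open import Data.List using (List; length; filterᵇ; allFin; cartesianProduct; upTo)
open import Data.Bool.ListAction using (all)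
open import Relation.Binary.PropositionalEquality using (_≡_; _≢_)
open import Relation.Binary.Construct.Closure.ReflexiveTransitive using (Star)

record Graph (n : ℕ) : Set where
  field
    adj   : Fin n → Fin n → Bool
    sym   : ∀ u v → adj u v ≡ adj v u
    loopless : ∀ v → adj v v ≡ false
open Graph public

Edge : ∀ {n} → Graph n → Fin n → Fin n → Set
Edge G u v = adj G u v ≡ true

SameGraph : ∀ {n} → Graph n → Graph n → Set
SameGraph G H = ∀ u v → adj G u v ≡ adj H u v

Connected : ∀ {n} → Graph n → Set
Connected G = ∀ u v → Star (Edge G) u v

neighbours : ∀ {n} → Graph n → Fin n → List (Fin n)
neighbours {n} G v = filterᵇ (adj G v) (allFin n)

degree : ∀ {n} → Graph n → Fin n → ℕ
degree G v = length (neighbours G v)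

Cubic : ∀ {n} → Graph n → Set
Cubic G = ∀ v → degree G v ≡ 3

-- Planarity via combinatorial embeddings (rotation systems) of genus 0.
iter : ∀ {A : Set} → (A → A) → ℕ → A → A
iter f zero    x = x
iter f (suc k) x = f (iter f k x)

-- ρ v u is the neighbour of v following u in the cyclic order around v.
-- ρ v is required to map N(v) into N(v) and to act transitively on N(v),
-- i.e. ρ v restricted to N(v) is a single cyclic permutation.
IsRotation : ∀ {n} → Graph n → (Fin n → Fin n → Fin n) → Set
IsRotation G ρ =
  (∀ v u → Edge G v u → Edge G v (ρ v u)) ×
  (∀ v u w → Edge G v u → Edge G v w → ∃ λ k → iter (ρ v) k u ≡ w)

Dart : ℕ → Set
Dart n = Fin n × Fin n

darts : ∀ {n} → Graph n → List (Dart n)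
darts {n} G = filterᵇ (λ d → adj G (proj₁ d) (proj₂ d)) (cartesianProduct (allFin n) (allFin n))

faceStep : ∀ {n} → (Fin n → Fin n → Fin n) → Dart n → Dart n
faceStep ρ (u , v) = (v , ρ v u)

dartKey : ∀ {n} → Dart n → ℕ
dartKey {n} (u , v) = toℕ u * n + toℕ v

-- a dart represents its face iff it has the least key in its face-orbit;
-- orbits have length ≤ (number of darts) ≤ n * n, so checking the first
-- n * n iterates covers the whole orbit.
isFaceRep : ∀ {n} → (Fin n → Fin n → Fin n) → Dart n → Bool
isFaceRep {n} ρ d = all (λ k → dartKey d ≤ᵇ dartKey (iter (faceStep ρ) k d)) (upTo (n * n))

numFaces : ∀ {n} → Graph n → (Fin n → Fin n → Fin n) → ℕ
numFaces G ρ = length (filterᵇ (isFaceRep ρ) (darts G))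

-- Euler's formula V - E + F = 2, with 2E = number of darts, written
-- without subtraction as 2V + 2F = 2E + 4.
Planar : ∀ {n} → Graph n → Set
Planar {n} G = Σ (Fin n → Fin n → Fin n) λ ρ →
  IsRotation G ρ × (2 * n + 2 * numFaces G ρ ≡ length (darts G) + 4)

-- T₃ membership for a 3-element subset {a,b,c} (a,b,c pairwise distinct):
-- the induced subgraph on {a,b,c} is connected, i.e. each pair is joined
-- either directly or through the third vertex.
joined : ∀ {n} → Graph n → Fin n → Fin n → Fin n → Bool
joined G x y z = adj G x y ∨ (adj G x z ∧ adj G z y)

inT3 : ∀ {n} → Graph n → Fin n → Fin n → Fin n → Bool
inT3 G a b c = joined G a b c ∧ joined G b c a ∧ joined G a c b

Distinct3 : ∀ {n} → Fin n → Fin n → Fin n → Set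
Distinct3 a b c = (a ≢ b) × (b ≢ c) × (a ≢ c)

SameT3 : ∀ {n} → Graph n → Graph n → Set
SameT3 G H = ∀ a b c → Distinct3 a b c → inT3 G a b c ≡ inT3 H a b c

InClass : ∀ {n} → Graph n → Set
InClass {n} G = (5 ≤ n) × Connected G × Cubic G × Planar G

-- If uv is an edge of G but not of H, then for every w outside {u, v} the triple
-- {u, v, w} lies in T₃(G) iff w is a G-neighbour of u or of v, and in T₃(H) iff w is
-- an H-neighbour of both u and v. So the four G-neighbours of u and v outside {u, v}
-- are H-neighbours of u, and 3-regularity of H forces two of them to coincide: G has a
-- triangle uvt. Since v is a G- but not an H-neighbour of u and both graphs are cubic,
-- u has an H-neighbour x that is not a G-neighbour, and likewise v has one, y. The same
-- rule applied to the H-edges ux and vy (with G and H swapped) makes t G-adjacent to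
-- x and y, so t has the four distinct G-neighbours u, v, x, y.
module Submission where

open import Defs
open import Data.Bool using (true; false; _∧_; _∨_)
open import Data.Bool.Properties using (¬-not; ⇔→≡; T-≡)
open import Data.Empty using (⊥; ⊥-elim)
open import Data.Fin using (Fin; _≟_)
open import Data.List using (List; []; _∷_; length; allFin)
open import Data.List.Properties using (length-removeAt′)
open import Data.List.Membership.Propositional using (_∈_; _∉_; _─_; find)
open import Data.List.Membership.Propositional.Properties using (∈-filter⁺; ∈-filter⁻; ∈-allFin)
import Data.List.Membership.DecPropositional as DecMembership
open import Data.List.Relation.Binary.Subset.Propositional using (_⊆_)
open import Data.List.Relation.Unary.All using (All; []; _∷_; all?; lookup; tabulate)
open import Data.List.Relation.Unary.All.Properties using (¬All⇒Any¬)
open import Data.List.Relation.Unary.AllPairs using ([]; _∷_)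
open import Data.List.Relation.Unary.Any using (here; there; index)
open import Data.List.Relation.Unary.Unique.Propositional using (Unique)
open import Data.List.Relation.Unary.Unique.Propositional.Properties using (filter⁺; allFin⁺)
open import Data.Nat using (ℕ; suc; _≤_; _<_; z≤n; s≤s)
open import Data.Nat.Properties using (≤-reflexive; <⇒≱; n≮n; module ≤-Reasoning)
open import Data.Product using (_×_; _,_; ∃; ∃₂; proj₁; proj₂)
open import Data.Sum using (_⊎_; inj₁; inj₂)
open import Function using (_∘_; mk⇔; Equivalence)
open import Relation.Binary.Definitions using (DecidableEquality)
open import Relation.Binary.PropositionalEquality
  using (_≡_; _≢_; refl; subst; ≢-sym; module ≡-Reasoning)
import Relation.Binary.PropositionalEquality as ≡
open import Relation.Nullary using (¬_; yes; no)
open import Relation.Nullary.Decidable using (T?)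

∨-true⁺ : ∀ {x y} → x ≡ true ⊎ y ≡ true → x ∨ y ≡ true
∨-true⁺ {true}  _              = refl
∨-true⁺ {false} (inj₁ ())
∨-true⁺ {false} (inj₂ y≡true) = y≡true

∨-true⁻ : ∀ {x y} → x ∨ y ≡ true → x ≡ true ⊎ y ≡ true
∨-true⁻ {true}  _      = inj₁ refl
∨-true⁻ {false} y≡true = inj₂ y≡true

∧-true⁺ : ∀ {x y} → x ≡ true → y ≡ true → x ∧ y ≡ true
∧-true⁺ refl refl = refl

∧-true⁻ : ∀ {x y} → x ∧ y ≡ true → x ≡ true × y ≡ true
∧-true⁻ {true}  {true}  _ = refl , refl
∧-true⁻ {true}  {false} ()
∧-true⁻ {false}         ()

module _ {a} {A : Set a} where

  ∈-─⁺ : ∀ {x y : A} {xs} (y∈xs : y ∈ xs) → x ∈ xs → x ≢ y → x ∈ xs ─ y∈xs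
  ∈-─⁺ (here refl)  (here refl)  x≢y = ⊥-elim (x≢y refl)
  ∈-─⁺ (here refl)  (there x∈xs) _   = x∈xs
  ∈-─⁺ (there y∈xs) (here refl)  _   = here refl
  ∈-─⁺ (there y∈xs) (there x∈xs) x≢y = there (∈-─⁺ y∈xs x∈xs x≢y)

  unique-⊆⇒length≤ : ∀ {xs ys : List A} → Unique ys → ys ⊆ xs → length ys ≤ length xs
  unique-⊆⇒length≤ []                                 _        = z≤n
  unique-⊆⇒length≤ {xs} {y ∷ ys} (y≢ys ∷ ys-unique) y∷ys⊆xs = begin
    suc (length ys)          ≤⟨ s≤s (unique-⊆⇒length≤ ys-unique ys⊆xs─y) ⟩
    suc (length (xs ─ y∈xs)) ≡⟨ length-removeAt′ xs (index y∈xs) ⟨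
    length xs                ∎
    where
    open ≤-Reasoning
    y∈xs : y ∈ xs
    y∈xs = y∷ys⊆xs (here refl)
    ys⊆xs─y : ys ⊆ xs ─ y∈xs
    ys⊆xs─y w∈ys = ∈-─⁺ y∈xs (y∷ys⊆xs (there w∈ys)) (≢-sym (lookup y≢ys w∈ys))

module _ {a} {A : Set a} (_≟ᴬ_ : DecidableEquality A) where

  open DecMembership _≟ᴬ_ using (_∈?_)

  unique-length<⇒∃∉ : ∀ {xs ys : List A} → Unique ys → length xs < length ys →
                      ∃ λ y → y ∈ ys × y ∉ xs
  unique-length<⇒∃∉ {xs} {ys} ys-unique xs<ys with all? (_∈? xs) ys
  ... | yes ys⊆xs = ⊥-elim (<⇒≱ xs<ys (unique-⊆⇒length≤ ys-unique (lookup ys⊆xs)))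
  ... | no  ys⊈xs = find (¬All⇒Any¬ (_∈? xs) ys ys⊈xs)

module _ {n} (G : Graph n) where

  Edge-sym : ∀ {u v} → Edge G u v → Edge G v u
  Edge-sym {u} {v} uv = ≡.trans (Graph.sym G v u) uv

  Edge⇒≢ : ∀ {u v} → Edge G u v → u ≢ v
  Edge⇒≢ {u} uv refl with ≡.trans (≡.sym uv) (loopless G u)
  ... | ()

  Edge-nonEdge⇒≢ : ∀ {u v w} → Edge G u v → adj G u w ≡ false → v ≢ w
  Edge-nonEdge⇒≢ uv uw refl with ≡.trans (≡.sym uv) uw
  ... | ()

  ∈-neighbours⁺ : ∀ {v w} → Edge G v w → w ∈ neighbours G v
  ∈-neighbours⁺ {v} {w} vw = ∈-filter⁺ (T? ∘ adj G v) (∈-allFin w) (Equivalence.from T-≡ vw)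

  ∈-neighbours⁻ : ∀ {v w} → w ∈ neighbours G v → Edge G v w
  ∈-neighbours⁻ {v} w∈N = Equivalence.to T-≡ (proj₂ (∈-filter⁻ (T? ∘ adj G v) {xs = allFin n} w∈N))

  neighbours-unique : ∀ v → Unique (neighbours G v)
  neighbours-unique v = filter⁺ (T? ∘ adj G v) (allFin⁺ n)

  distinct-neighbours≤degree : ∀ {v ws} → Unique ws → All (Edge G v) ws → length ws ≤ degree G v
  distinct-neighbours≤degree ws-unique vws =
    unique-⊆⇒length≤ ws-unique (∈-neighbours⁺ ∘ lookup vws)

  ∃-neighbour∉ : ∀ {v} ws → length ws < degree G v → ∃ λ x → Edge G v x × x ∉ ws
  ∃-neighbour∉ {v} ws ws<deg with unique-length<⇒∃∉ _≟_ (neighbours-unique v) ws<deg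
  ... | x , x∈N , x∉ws = x , ∈-neighbours⁻ x∈N , x∉ws

module _ {n} (G : Graph n) (cubic : Cubic G) where

  no-four-neighbours : ∀ {v a b c d} → Unique (a ∷ b ∷ c ∷ d ∷ []) →
                       All (Edge G v) (a ∷ b ∷ c ∷ d ∷ []) → ⊥
  no-four-neighbours {v} distinct va =
    n≮n 3 (subst (4 ≤_) (cubic v) (distinct-neighbours≤degree G distinct va))

  two-neighbours-besides : ∀ u v → ∃₂ λ a b → Edge G u a × Edge G u b × a ≢ b × a ≢ v × b ≢ v
  two-neighbours-besides u v
    with a , ua , a∉[v]   ← ∃-neighbour∉ G (v ∷ [])     (subst (1 <_) (≡.sym (cubic u)) (s≤s (s≤s z≤n)))
    with b , ub , b∉[v,a] ← ∃-neighbour∉ G (v ∷ a ∷ []) (subst (2 <_) (≡.sym (cubic u)) (s≤s (s≤s (s≤s z≤n))))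
    = a , b , ua , ub , (λ a≡b → b∉[v,a] (there (here (≡.sym a≡b))))
    , a∉[v] ∘ here , b∉[v,a] ∘ here

lost-neighbour⇒gained-neighbour : ∀ {n} (G H : Graph n) {u v} → degree G u ≤ degree H u →
                                  Edge G u v → adj H u v ≡ false →
                                  ∃ λ x → Edge H u x × adj G u x ≡ false
lost-neighbour⇒gained-neighbour G H {u} {v} degG≤degH uv∈G uv∉H
  with unique-length<⇒∃∉ _≟_ v∷NH-unique (s≤s degG≤degH)
  where
  v∷NH-unique : Unique (v ∷ neighbours H u)
  v∷NH-unique = tabulate (λ w∈NH → ≢-sym (Edge-nonEdge⇒≢ H (∈-neighbours⁻ H w∈NH) uv∉H))
              ∷ neighbours-unique H u
... | _ , here refl , v∉NG = ⊥-elim (v∉NG (∈-neighbours⁺ G uv∈G))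
... | x , there x∈NH , x∉NG = x , ∈-neighbours⁻ H x∈NH , ¬-not (x∉NG ∘ ∈-neighbours⁺ G)

module _ {n} (G : Graph n) {u v w : Fin n} where

  inT3-edge : Edge G u v → inT3 G u v w ≡ adj G u w ∨ adj G v w
  inT3-edge uv rewrite Graph.sym G w v | Graph.sym G v u | uv with adj G u w | adj G v w
  ... | true  | true  = refl
  ... | true  | false = refl
  ... | false | true  = refl
  ... | false | false = refl

  inT3-nonEdge : adj G u v ≡ false → inT3 G u v w ≡ adj G u w ∧ adj G v w
  inT3-nonEdge uv rewrite Graph.sym G w v | Graph.sym G v u | uv with adj G u w | adj G v w
  ... | true  | true  = refl
  ... | true  | false = refl
  ... | false | true  = refl
  ... | false | false = refl

SameT3-sym : ∀ {n} (G H : Graph n) → SameT3 G H → SameT3 H G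
SameT3-sym G H same a b c distinct = ≡.sym (same a b c distinct)

module Transfer {n} (G H : Graph n) (same : SameT3 G H)
                {u v} (uv∈G : Edge G u v) (uv∉H : adj H u v ≡ false) where

  transfer : ∀ {w} → v ≢ w → u ≢ w → adj G u w ∨ adj G v w ≡ adj H u w ∧ adj H v w
  transfer {w} v≢w u≢w = begin
    adj G u w ∨ adj G v w ≡⟨ inT3-edge G uv∈G ⟨
    inT3 G u v w          ≡⟨ same u v w (Edge⇒≢ G uv∈G , v≢w , u≢w) ⟩
    inT3 H u v w          ≡⟨ inT3-nonEdge H uv∉H ⟩
    adj H u w ∧ adj H v w ∎
    where open ≡-Reasoning

  transfer⁺ : ∀ {w} → v ≢ w → u ≢ w → Edge G u w ⊎ Edge G v w → Edge H u w × Edge H v w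
  transfer⁺ v≢w u≢w uw⊎vw = ∧-true⁻ (≡.trans (≡.sym (transfer v≢w u≢w)) (∨-true⁺ uw⊎vw))

  transfer⁻ : ∀ {w} → v ≢ w → u ≢ w → Edge H u w → Edge H v w → Edge G u w ⊎ Edge G v w
  transfer⁻ v≢w u≢w uw vw = ∨-true⁻ (≡.trans (transfer v≢w u≢w) (∧-true⁺ uw vw))

module _ {n} (G H : Graph n) (cubicG : Cubic G) (cubicH : Cubic H) (same : SameT3 G H)
         {u v} (uv∈G : Edge G u v) (uv∉H : adj H u v ≡ false) where

  open Transfer G H same uv∈G uv∉H

  private
    vu∉H : adj H v u ≡ false
    vu∉H = ≡.trans (Graph.sym H v u) uv∉H

    same-degree : ∀ w → degree G w ≤ degree H w
    same-degree w = ≤-reflexive (≡.trans (cubicG w) (≡.sym (cubicH w)))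

  triangle : ∃ λ t → Edge G u t × Edge G v t
  triangle
    with a , b , ua , ub , a≢b , a≢v , b≢v ← two-neighbours-besides G cubicG u v
    with c , d , vc , vd , c≢d , c≢u , d≢u ← two-neighbours-besides G cubicG v u
    with adj G v a in va | adj G v b in vb
  ... | true  | _    = a , ua , va
  ... | false | true = b , ub , vb
  ... | false | false = ⊥-elim (no-four-neighbours H cubicH
         ((a≢b ∷ ≢-sym (Edge-nonEdge⇒≢ G vc va) ∷ ≢-sym (Edge-nonEdge⇒≢ G vd va) ∷ [])
          ∷ (≢-sym (Edge-nonEdge⇒≢ G vc vb) ∷ ≢-sym (Edge-nonEdge⇒≢ G vd vb) ∷ [])
          ∷ (c≢d ∷ []) ∷ [] ∷ [])
         (from-u a≢v ua ∷ from-u b≢v ub ∷ from-v c≢u vc ∷ from-v d≢u vd ∷ []))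
    where
    from-u : ∀ {w} → w ≢ v → Edge G u w → Edge H u w
    from-u w≢v uw = proj₁ (transfer⁺ (≢-sym w≢v) (Edge⇒≢ G uw) (inj₁ uw))
    from-v : ∀ {w} → w ≢ u → Edge G v w → Edge H u w
    from-v w≢u vw = proj₁ (transfer⁺ (Edge⇒≢ G vw) (≢-sym w≢u) (inj₂ vw))

  apex-has-four-neighbours : ∀ {t x y} → Edge G u t → Edge G v t →
                             Edge H u x → adj G u x ≡ false → Edge H v y → adj G v y ≡ false → ⊥
  apex-has-four-neighbours {t} {x} {y} ut vt ux∈H ux∉G vy∈H vy∉G =
    no-four-neighbours G cubicG
      ((u≢v ∷ u≢x ∷ u≢y ∷ []) ∷ (v≢x ∷ v≢y ∷ []) ∷ (x≢y ∷ []) ∷ [] ∷ [])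
      (Edge-sym G ut ∷ Edge-sym G vt ∷ Edge-sym G xt ∷ Edge-sym G yt ∷ [])
    where
    u≢v : u ≢ v
    u≢v = Edge⇒≢ G uv∈G
    u≢x : u ≢ x
    u≢x = Edge⇒≢ H ux∈H
    u≢y : u ≢ y
    u≢y = ≢-sym (Edge-nonEdge⇒≢ H vy∈H vu∉H)
    v≢x : v ≢ x
    v≢x = ≢-sym (Edge-nonEdge⇒≢ H ux∈H uv∉H)
    v≢y : v ≢ y
    v≢y = Edge⇒≢ H vy∈H

    t∈H : Edge H u t × Edge H v t
    t∈H = transfer⁺ (Edge⇒≢ G vt) (Edge⇒≢ G ut) (inj₁ ut)

    xt : Edge G x t
    xt = proj₂ (Transfer.transfer⁺ H G (SameT3-sym G H same) ux∈H ux∉G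
                  (≢-sym (Edge-nonEdge⇒≢ G ut ux∉G)) (Edge⇒≢ G ut) (inj₁ (proj₁ t∈H)))

    yt : Edge G y t
    yt = proj₂ (Transfer.transfer⁺ H G (SameT3-sym G H same) vy∈H vy∉G
                  (≢-sym (Edge-nonEdge⇒≢ G vt vy∉G)) (Edge⇒≢ G vt) (inj₁ (proj₂ t∈H)))

    x≢y : x ≢ y
    x≢y refl with transfer⁻ v≢x u≢x ux∈H vy∈H
    ... | inj₁ ux∈G = Edge-nonEdge⇒≢ G ux∈G ux∉G refl
    ... | inj₂ vx∈G = Edge-nonEdge⇒≢ G vx∈G vy∉G refl

  no-edge-lost : ⊥
  no-edge-lost
    with t , ut , vt ← triangle
    with x , ux∈H , ux∉G ← lost-neighbour⇒gained-neighbour G H (same-degree u) uv∈G uv∉H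
    with y , vy∈H , vy∉G ← lost-neighbour⇒gained-neighbour G H (same-degree v) (Edge-sym G uv∈G) vu∉H
    = apex-has-four-neighbours ut vt ux∈H ux∉G vy∈H vy∉G

cubic-SameT3⇒Edge : ∀ {n} (G H : Graph n) → Cubic G → Cubic H → SameT3 G H →
                    ∀ {u v} → Edge G u v → Edge H u v
cubic-SameT3⇒Edge G H cubicG cubicH same {u} {v} uv∈G with adj H u v in uv∉H
... | true  = refl
... | false = ⊥-elim (no-edge-lost G H cubicG cubicH same uv∈G uv∉H)

lemma3p8 : ∀ {n : ℕ} (G₁ G₂ : Graph n) → InClass G₁ → InClass G₂
           → ¬ SameGraph G₁ G₂ → ¬ SameT3 G₁ G₂
lemma3p8 G₁ G₂ (_ , _ , cubic₁ , _) (_ , _ , cubic₂ , _) G₁≠G₂ same =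
  G₁≠G₂ λ u v → ⇔→≡ (mk⇔ (cubic-SameT3⇒Edge G₁ G₂ cubic₁ cubic₂ same)
                          (cubic-SameT3⇒Edge G₂ G₁ cubic₂ cubic₁ (SameT3-sym G₁ G₂ same)))
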